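{- Let $G$ be a graph of order $n\geqslant 5$, and let $\overline{G}$ be its complement. Then: (1) if $n=5$ or $n$ is even, then $n\leqslant \chi_i(G)+\chi_i(\overline{G})\leqslant 2n$; (2) if $n\geqslant 7$ is odd, then $n+1\leqslant \chi_i(G)+\chi_i(\overline{G})\leqslant 2n$.
   Context: All graphs are finite and simple; the order of a graph is its number of vertices, and $\overline{G}$ denotes the complement of $G$. A mapping $f:V(G)\to\{1,\ldots,k\}$ is an injective $k$-coloring of $G$ if $f(u)\neq f(v)$ whenever the distinct vertices $u$ and $v$ have a common neighbor in $G$ (adjacent vertices without a common neighbor may receive the same color). The injective chromatic number $\chi_i(G)$ is the minimum $k$ such that $G$ has an injective $k$-coloring. -}

module Defs where

open import Data.Nat using (ℕ; _≤_)
open import Data.Fin using (Fin)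
open import Data.Bool using (Bool; true; false; not; if_then_else_)
import Data.Empty
open import Data.Product using (Σ; ∃; _×_)
open import Relation.Binary.PropositionalEquality using (_≡_; _≢_)
open import Relation.Nullary using (¬_; does)
open import Data.Fin.Properties using (_≟_)

record Graph (n : ℕ) : Set where
  field
    adj   : Fin n → Fin n → Bool
    sym   : ∀ u v → adj u v ≡ adj v u
    irref : ∀ u → adj u u ≡ false
open Graph public

compAdj : ∀ {n} → Graph n → Fin n → Fin n → Bool
compAdj G u v = if does (u ≟ v) then false else not (adj G u v)

private
  open import Relation.Nullary using (yes; no)
  open import Relation.Binary.PropositionalEquality using (refl) renaming (sym to ≡sym)

  compSym : ∀ {n} (G : Graph n) u v → compAdj G u v ≡ compAdj G v u
  compSym G u v with u ≟ v | v ≟ u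
  ... | yes _ | yes _ = refl
  ... | yes p | no ¬q = Data.Empty.⊥-elim (¬q (≡sym p))
  ... | no ¬p | yes q = Data.Empty.⊥-elim (¬p (≡sym q))
  ... | no _ | no _ rewrite Graph.sym G u v = refl

  compIrref : ∀ {n} (G : Graph n) u → compAdj G u u ≡ false
  compIrref G u with u ≟ u
  ... | yes _ = refl
  ... | no ¬p = Data.Empty.⊥-elim (¬p refl)

complement : ∀ {n} → Graph n → Graph n
complement G = record { adj = compAdj G ; sym = compSym G ; irref = compIrref G }

IsInjectiveColoring : ∀ {n} (G : Graph n) (k : ℕ) → (Fin n → Fin k) → Set
IsInjectiveColoring G k f =
  ∀ u v w → u ≢ v → adj G u w ≡ true → adj G v w ≡ true → f u ≢ f v

InjColorable : ∀ {n} → Graph n → ℕ → Set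
InjColorable {n} G k = Σ (Fin n → Fin k) (IsInjectiveColoring G k)

IsInjChromaticNumber : ∀ {n} → Graph n → ℕ → Set
IsInjChromaticNumber G k = InjColorable G k × (∀ m → InjColorable G m → k ≤ m)

-- The upper bound comes from giving every vertex its own colour.  For the lower
-- bounds fix injective colourings of G and Ḡ with p and q colours.  The neighbours
-- of a vertex pairwise share it, so their colours differ: deg_G ≤ p, deg_Ḡ ≤ q.  As
-- deg_G v + deg_Ḡ v = n - 1, G has minimum degree δ ≥ n - 1 - q (and Ḡ ≥ n - 1 - p).
-- Two vertices of one class have no common neighbour, so every vertex has at most
-- one neighbour per class: a class's degrees sum to at most n, hence |class|·δ ≤ n,
-- and summing over the classes gives n ≤ p·K when n < (K+1)·δ.  In a class of
-- exactly three vertices some vertex has no neighbour inside the class, so its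
-- degree sum is below n; this settles the boundary case n = 3δ and the exceptional
-- case n = 7, p = 3, q = 4.  A case analysis on p, q and n finishes the proof.
module Submission where

open import Defs
open import Data.Nat using (ℕ; _≤_; _+_; _*_; suc)
open import Data.Nat.Divisibility using (_∣_)
open import Relation.Nullary using (¬_)
open import Data.Product using (_×_)
open import Data.Sum using (_⊎_)
open import Relation.Binary.PropositionalEquality using (_≡_)

open import Data.Nat using (zero; _<_; z≤n; s≤s; _≤?_)
open import Data.Nat.Properties hiding (_≟_)
open import Data.Nat.Divisibility using (divides)
open import Data.Nat.Tactic.RingSolver using (solve)
open import Data.Bool using (Bool; true; false; not; _∧_; _∨_)
open import Data.Bool.Properties using (∧-identityʳ; ∨-zeroʳ; ¬-not) renaming (_≟_ to _≟ᵇ_)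
open import Data.Fin using (Fin; zero; suc; punchIn)
open import Data.Fin.Properties using (_≟_; any?; punchInᵢ≢i)
open import Data.List using (_∷_; [])
open import Data.Product using (∃; Σ; _,_; proj₁; proj₂)
open import Data.Sum using (inj₁; inj₂; [_,_])
open import Data.Empty using (⊥)
open import Function using (_∘_)
open import Relation.Nullary using (yes; no; does; contradiction)
open import Relation.Nullary.Decidable using (dec-true; dec-false)
open import Relation.Binary.PropositionalEquality
  using (_≢_; ≢-sym; refl; trans; cong; cong₂; subst; subst₂; module ≡-Reasoning)
  renaming (sym to ≡-sym)
open import Algebra.Properties.Semiring.Sum +-*-semiring
  using (sum; sum-cong-≗; sum-remove; sum-replicate-zero; ∑-comm; ∑-distrib-+;
         *-distribˡ-sum; *-distribʳ-sum)

≤-by : ∀ {a b} c → a + c ≡ b → a ≤ b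
≤-by {a} c refl = m≤m+n a c

∑-mono : ∀ {n} {f g : Fin n → ℕ} → (∀ x → f x ≤ g x) → sum f ≤ sum g
∑-mono {zero}  _   = z≤n
∑-mono {suc n} f≤g = +-mono-≤ (f≤g zero) (∑-mono (f≤g ∘ suc))

∑-const : ∀ n k → sum {n} (λ _ → k) ≡ n * k
∑-const zero    k = refl
∑-const (suc n) k = cong (k +_) (∑-const n k)

∑-≤1 : ∀ {n} {f : Fin n → ℕ} → (∀ x → f x ≤ 1) → sum f ≤ n
∑-≤1 {n} f≤1 = ≤-trans (∑-mono f≤1) (≤-reflexive (trans (∑-const n 1) (*-identityʳ n)))

∑-≤1-gap : ∀ {n} {f : Fin n → ℕ} → (∀ x → f x ≤ 1) → ∀ z → f z ≡ 0 → sum f < n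
∑-≤1-gap {suc n} {f} f≤1 z fz≡0 = s≤s (begin
  sum f                     ≡⟨ sum-remove {i = z} f ⟩
  f z + sum (f ∘ punchIn z) ≡⟨ cong (_+ sum (f ∘ punchIn z)) fz≡0 ⟩
  sum (f ∘ punchIn z)       ≤⟨ ∑-≤1 (f≤1 ∘ punchIn z) ⟩
  n                         ∎)
  where open ≤-Reasoning

_==_ : ∀ {n} → Fin n → Fin n → Bool
x == y = does (x ≟ y)

==-sound : ∀ {n} {x y : Fin n} → (x == y) ≡ true → x ≡ y
==-sound {x = x} {y} eq with x ≟ y
... | yes x≡y = x≡y

ι : Bool → ℕ
ι true  = 1
ι false = 0

∑-pick : ∀ {n} (x : Fin n) (F : Fin n → ℕ) → sum (λ u → ι (u == x) * F u) ≡ F x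
∑-pick {suc n} x F = begin
  sum (λ u → ι (u == x) * F u)
    ≡⟨ sum-remove {i = x} (λ u → ι (u == x) * F u) ⟩
  ι (x == x) * F x + sum (λ j → ι (punchIn x j == x) * F (punchIn x j))
    ≡⟨ cong₂ _+_ (cong (λ b → ι b * F x) (dec-true (x ≟ x) refl))
                 (sum-cong-≗ λ j → cong (λ b → ι b * F (punchIn x j))
                                        (dec-false (punchIn x j ≟ x) (punchInᵢ≢i x j))) ⟩
  F x + 0 + sum {n} (λ _ → 0)
    ≡⟨ cong₂ _+_ (+-identityʳ (F x)) (sum-replicate-zero n) ⟩
  F x + 0
    ≡⟨ +-identityʳ (F x) ⟩
  F x ∎
  where open ≡-Reasoning

count : ∀ {n} → (Fin n → Bool) → ℕ
count P = sum (λ x → ι (P x))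

∑∈ : ∀ {n} → (Fin n → Bool) → (Fin n → ℕ) → ℕ
∑∈ P F = sum (λ x → ι (P x) * F x)

∧-true : ∀ {a b} → a ∧ b ≡ true → a ≡ true × b ≡ true
∧-true {true} {true} _ = refl , refl

ι-∧ : ∀ a b → ι (a ∧ b) ≡ ι a * ι b
ι-∧ true  b = ≡-sym (+-identityʳ (ι b))
ι-∧ false b = refl

infixl 6 _─_
_─_ : ∀ {n} → (Fin n → Bool) → Fin n → Fin n → Bool
(P ─ x) u = P u ∧ not (u == x)

─-intro : ∀ {n} {P : Fin n → Bool} {x u} → P u ≡ true → u ≢ x → (P ─ x) u ≡ true
─-intro {x = x} {u} Pu u≢x rewrite Pu | dec-false (u ≟ x) u≢x = refl

─-elim : ∀ {n} {P : Fin n → Bool} {x u} → (P ─ x) u ≡ true → P u ≡ true × u ≢ x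
─-elim {P = P} {x} {u} h with P u | u ≟ x
... | true | no u≢x = refl , u≢x

count-all : ∀ n → count {n} (λ _ → true) ≡ n
count-all n = trans (∑-const n 1) (*-identityʳ n)

count-none : ∀ {n} {P : Fin n → Bool} → (∀ x → P x ≡ false) → count P ≡ 0
count-none {n} none = trans (sum-cong-≗ (λ x → cong ι (none x))) (sum-replicate-zero n)

count-singleton : ∀ {n} (x : Fin n) → count (_== x) ≡ 1
count-singleton x = trans (sum-cong-≗ λ u → ≡-sym (*-identityʳ (ι (u == x)))) (∑-pick x (λ _ → 1))

count-mono : ∀ {n} {P Q : Fin n → Bool} → (∀ x → P x ≡ true → Q x ≡ true) → count P ≤ count Q
count-mono {P = P} {Q} P⊆Q = ∑-mono pointwise
  where
  pointwise : ∀ x → ι (P x) ≤ ι (Q x)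
  pointwise x with P x in Px
  ... | false = z≤n
  ... | true  rewrite P⊆Q x Px = ≤-refl

count-∨ : ∀ {n} (P Q : Fin n → Bool) → count (λ x → P x ∨ Q x) ≤ count P + count Q
count-∨ P Q = ≤-trans (∑-mono pointwise) (≤-reflexive (∑-distrib-+ (ι ∘ P) (ι ∘ Q)))
  where
  pointwise : ∀ x → ι (P x ∨ Q x) ≤ ι (P x) + ι (Q x)
  pointwise x with P x
  ... | true  = s≤s z≤n
  ... | false = ≤-refl

count-cover : ∀ {n} (P Q : Fin n → Bool) → (∀ x → (P x ∨ Q x) ≡ true) → n ≤ count P + count Q
count-cover {n} P Q covered = begin
  n                        ≡⟨ ≡-sym (count-all n) ⟩
  count {n} (λ _ → true)   ≤⟨ count-mono (λ x _ → covered x) ⟩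
  count (λ x → P x ∨ Q x)  ≤⟨ count-∨ P Q ⟩
  count P + count Q        ∎
  where open ≤-Reasoning

empty-or-witness : ∀ {n} (P : Fin n → Bool) → (∀ x → P x ≡ false) ⊎ ∃ λ x → P x ≡ true
empty-or-witness P with any? (λ x → P x ≟ᵇ true)
... | yes found = inj₂ found
... | no  none  = inj₁ (λ x → ¬-not (λ Px → none (x , Px)))

count-witness : ∀ {n} {P : Fin n → Bool} → 1 ≤ count P → ∃ λ x → P x ≡ true
count-witness {P = P} 1≤count with empty-or-witness P
... | inj₁ none  = contradiction (≤-trans 1≤count (≤-reflexive (count-none none))) λ ()
... | inj₂ found = found

∑∈-remove : ∀ {n} {P : Fin n → Bool} (F : Fin n → ℕ) {x} → P x ≡ true →
            ∑∈ P F ≡ F x + ∑∈ (P ─ x) F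
∑∈-remove {P = P} F {x} Px = begin
  ∑∈ P F
    ≡⟨ sum-cong-≗ split ⟩
  sum (λ u → ι (u == x) * F u + ι ((P ─ x) u) * F u)
    ≡⟨ ∑-distrib-+ (λ u → ι (u == x) * F u) (λ u → ι ((P ─ x) u) * F u) ⟩
  sum (λ u → ι (u == x) * F u) + ∑∈ (P ─ x) F
    ≡⟨ cong (_+ ∑∈ (P ─ x) F) (∑-pick x F) ⟩
  F x + ∑∈ (P ─ x) F ∎
  where
  open ≡-Reasoning
  split : ∀ u → ι (P u) * F u ≡ ι (u == x) * F u + ι ((P ─ x) u) * F u
  split u with u ≟ x
  ... | yes refl rewrite Px = ≡-sym (+-identityʳ _)
  ... | no  _    rewrite ∧-identityʳ (P u) = refl

count-remove : ∀ {n} {P : Fin n → Bool} {x} → P x ≡ true → count P ≡ suc (count (P ─ x))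
count-remove {P = P} {x} Px = begin
  count P                     ≡⟨ as-sum P ⟩
  ∑∈ P (λ _ → 1)              ≡⟨ ∑∈-remove {P = P} (λ _ → 1) Px ⟩
  suc (∑∈ (P ─ x) (λ _ → 1))  ≡⟨ cong suc (≡-sym (as-sum (P ─ x))) ⟩
  suc (count (P ─ x))         ∎
  where
  open ≡-Reasoning
  as-sum : ∀ Q → count Q ≡ ∑∈ Q (λ _ → 1)
  as-sum Q = sum-cong-≗ λ u → ≡-sym (*-identityʳ (ι (Q u)))

∑∈-≥ : ∀ {n} (P : Fin n → Bool) {F : Fin n → ℕ} {δ} → (∀ u → δ ≤ F u) → count P * δ ≤ ∑∈ P F
∑∈-≥ P {F} {δ} δ≤F = begin
  count P * δ              ≡⟨ *-distribʳ-sum δ (ι ∘ P) ⟩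
  sum (λ u → ι (P u) * δ)  ≤⟨ ∑-mono (λ u → *-monoʳ-≤ (ι (P u)) (δ≤F u)) ⟩
  ∑∈ P F                   ∎
  where open ≤-Reasoning

count-≤1 : ∀ {n} {P : Fin n → Bool} → (∀ x y → P x ≡ true → P y ≡ true → x ≡ y) → count P ≤ 1
count-≤1 {P = P} unique with empty-or-witness P
... | inj₁ none = ≤-trans (≤-reflexive (count-none none)) z≤n
... | inj₂ (x , Px) = ≤-reflexive (trans (count-remove {P = P} Px) (cong suc (count-none {P = P ─ x} only-x)))
  where
  only-x : ∀ u → (P ─ x) u ≡ false
  only-x u with P u in Pu
  ... | false = refl
  ... | true  = cong not (dec-true (u ≟ x) (unique u x Pu Px))

count-fibres : ∀ {n k} (P : Fin n → Bool) (f : Fin n → Fin k) →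
               count P ≡ sum (λ c → count (λ x → P x ∧ (c == f x)))
count-fibres {k = k} P f = trans (sum-cong-≗ (≡-sym ∘ one-fibre)) (∑-comm (λ x c → ι (P x ∧ (c == f x))))
  where
  one-fibre : ∀ x → sum (λ c → ι (P x ∧ (c == f x))) ≡ ι (P x)
  one-fibre x with P x
  ... | false = sum-replicate-zero k
  ... | true  = trans (sum-cong-≗ λ c → ≡-sym (*-identityʳ (ι (c == f x)))) (∑-pick (f x) (λ _ → 1))

InjectiveOn : ∀ {n k} → (Fin n → Bool) → (Fin n → Fin k) → Set
InjectiveOn P f = ∀ x y → P x ≡ true → P y ≡ true → f x ≡ f y → x ≡ y

fibre-≤1 : ∀ {n k} {P : Fin n → Bool} {f : Fin n → Fin k} → InjectiveOn P f →
           ∀ c → count (λ x → P x ∧ (c == f x)) ≤ 1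
fibre-≤1 {P = P} {f} inj c = count-≤1 λ x y Px Py →
  let (Px , c≡fx) = ∧-true {P x} Px ; (Py , c≡fy) = ∧-true {P y} Py
  in inj x y Px Py (trans (≡-sym (==-sound {x = c} c≡fx)) (==-sound {x = c} c≡fy))

count-injective : ∀ {n k} {P : Fin n → Bool} {f : Fin n → Fin k} → InjectiveOn P f → count P ≤ k
count-injective {P = P} {f} inj =
  ≤-trans (≤-reflexive (count-fibres P f)) (∑-≤1 (fibre-≤1 inj))

count-surjective : ∀ {n k} {P : Fin n → Bool} {f : Fin n → Fin k} → InjectiveOn P f → k ≤ count P →
                   ∀ c → ∃ λ x → P x ≡ true × f x ≡ c
count-surjective {P = P} {f} inj k≤count c with empty-or-witness (λ x → P x ∧ (c == f x))
... | inj₁ empty = contradiction k≤count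
      (<⇒≱ (≤-trans (s≤s (≤-reflexive (count-fibres P f)))
                     (∑-≤1-gap (fibre-≤1 inj) c (count-none empty))))
... | inj₂ (x , hit) = let (Px , c≡fx) = ∧-true {P x} hit in x , Px , ≡-sym (==-sound {x = c} c≡fx)

count-member : ∀ {n} {P : Fin n → Bool} {x} → P x ≡ true → 1 ≤ count P
count-member {P = P} Px = ≤-trans (s≤s z≤n) (≤-reflexive (≡-sym (count-remove {P = P} Px)))

remove-one : ∀ {n} {P : Fin n → Bool} {k} → count P ≡ suc k →
             ∃ λ x → P x ≡ true × count (P ─ x) ≡ k
remove-one {P = P} count≡1+k
  with count-witness {P = P} (≤-trans (s≤s z≤n) (≤-reflexive (≡-sym count≡1+k)))
... | x , Px = x , Px , suc-injective (trans (≡-sym (count-remove {P = P} Px)) count≡1+k)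

record Triple {n} (P : Fin n → Bool) : Set where
  field
    x y z : Fin n
    x∈ : P x ≡ true
    y∈ : P y ≡ true
    z∈ : P z ≡ true
    x≢y : x ≢ y
    x≢z : x ≢ z
    y≢z : y ≢ z
    only : ∀ w → P w ≡ true → w ≡ x ⊎ w ≡ y ⊎ w ≡ z

count≡3⇒Triple : ∀ {n} {P : Fin n → Bool} → count P ≡ 3 → Triple P
count≡3⇒Triple {P = P} count≡3 with remove-one {P = P} count≡3
... | x , x∈ , count₂ with remove-one {P = P ─ x} count₂
... | y , y∈′ , count₁ with remove-one {P = P ─ x ─ y} count₁
... | z , z∈″ , count₀ = record
  { x = x ; y = y ; z = z ; x∈ = x∈ ; y∈ = y∈ ; z∈ = z∈
  ; x≢y = ≢-sym y≢x ; x≢z = ≢-sym z≢x ; y≢z = ≢-sym z≢y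
  ; only = only }
  where
  y∈ : P y ≡ true
  y∈ = proj₁ (─-elim {P = P} y∈′)
  y≢x : y ≢ x
  y≢x = proj₂ (─-elim {P = P} y∈′)
  z∈′ : (P ─ x) z ≡ true
  z∈′ = proj₁ (─-elim {P = P ─ x} z∈″)
  z≢y : z ≢ y
  z≢y = proj₂ (─-elim {P = P ─ x} z∈″)
  z∈ : P z ≡ true
  z∈ = proj₁ (─-elim {P = P} z∈′)
  z≢x : z ≢ x
  z≢x = proj₂ (─-elim {P = P} z∈′)
  only : ∀ w → P w ≡ true → w ≡ x ⊎ w ≡ y ⊎ w ≡ z
  only w Pw with w ≟ x | w ≟ y | w ≟ z
  ... | yes w≡x | _        | _        = inj₁ w≡x
  ... | no _    | yes w≡y  | _        = inj₂ (inj₁ w≡y)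
  ... | no _    | no _     | yes w≡z  = inj₂ (inj₂ w≡z)
  ... | no w≢x  | no w≢y   | no w≢z   = contradiction
    (≤-trans (count-member {P = P ─ x ─ y ─ z} w∈rest) (≤-reflexive count₀)) λ ()
    where
    w∈rest : (P ─ x ─ y ─ z) w ≡ true
    w∈rest = ─-intro {P = P ─ x ─ y} (─-intro {P = P ─ x} (─-intro {P = P} Pw w≢x) w≢y) w≢z

swap₁₂ : ∀ {n} {P : Fin n → Bool} → Triple P → Triple P
swap₁₂ t = record
  { x = y ; y = x ; z = z ; x∈ = y∈ ; y∈ = x∈ ; z∈ = z∈
  ; x≢y = ≢-sym x≢y ; x≢z = y≢z ; y≢z = x≢z
  ; only = λ w Pw → [ inj₂ ∘ inj₁ , [ inj₁ , inj₂ ∘ inj₂ ] ] (only w Pw) }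
  where open Triple t

swap₂₃ : ∀ {n} {P : Fin n → Bool} → Triple P → Triple P
swap₂₃ t = record
  { x = x ; y = z ; z = y ; x∈ = x∈ ; y∈ = z∈ ; z∈ = y∈
  ; x≢y = x≢z ; x≢z = x≢y ; y≢z = ≢-sym y≢z
  ; only = λ w Pw → [ inj₁ , [ inj₂ ∘ inj₂ , inj₂ ∘ inj₁ ] ] (only w Pw) }
  where open Triple t

deg : ∀ {n} → Graph n → Fin n → ℕ
deg G v = count (adj G v)

adj⇒≢ : ∀ {n} (G : Graph n) {u v} → adj G u v ≡ true → u ≢ v
adj⇒≢ G {u} Guv refl = contradiction (trans (≡-sym (irref G u)) Guv) λ ()

module InjectiveColouring {n} (G : Graph n) {p} {f : Fin n → Fin p}
                          (f-inj : IsInjectiveColoring G p f) where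

  common-neighbour : ∀ {u u′ w} → adj G u w ≡ true → adj G u′ w ≡ true → f u ≡ f u′ → u ≡ u′
  common-neighbour {u} {u′} {w} uw u′w fu≡fu′ with u ≟ u′
  ... | yes u≡u′ = u≡u′
  ... | no  u≢u′ = contradiction fu≡fu′ (f-inj u u′ w u≢u′ uw u′w)

  neighbourhood-injective : ∀ v → InjectiveOn (adj G v) f
  neighbourhood-injective v x y vx vy = common-neighbour (trans (sym G x v) vx) (trans (sym G y v) vy)

  deg≤colours : ∀ v → deg G v ≤ p
  deg≤colours v = count-injective (neighbourhood-injective v)

  colour-repeats : ∀ z → p ≤ deg G z → ∃ λ u → adj G z u ≡ true × f u ≡ f z
  colour-repeats z p≤deg = count-surjective (neighbourhood-injective z) p≤deg (f z)

  class : Fin p → Fin n → Bool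
  class c u = c == f u

  same-class : ∀ {c u u′} → class c u ≡ true → class c u′ ≡ true → f u ≡ f u′
  same-class {c} cu cu′ = trans (≡-sym (==-sound {x = c} cu)) (==-sound {x = c} cu′)

  class-neighbours : Fin p → Fin n → ℕ
  class-neighbours c w = count (λ u → class c u ∧ adj G u w)

  class-neighbours-≤1 : ∀ c w → class-neighbours c w ≤ 1
  class-neighbours-≤1 c w = count-≤1 λ u u′ h h′ →
    let (cu , uw) = ∧-true {class c u} h ; (cu′ , u′w) = ∧-true {class c u′} h′
    in common-neighbour uw u′w (same-class {c} cu cu′)

  class-degree-sum : ∀ c → ∑∈ (class c) (deg G) ≡ sum (class-neighbours c)
  class-degree-sum c = begin
    sum (λ u → ι (class c u) * sum (λ w → ι (adj G u w)))
      ≡⟨ sum-cong-≗ (λ u → *-distribˡ-sum (ι (class c u)) (λ w → ι (adj G u w))) ⟩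
    sum (λ u → sum (λ w → ι (class c u) * ι (adj G u w)))
      ≡⟨ sum-cong-≗ (λ u → sum-cong-≗ (λ w → ≡-sym (ι-∧ (class c u) (adj G u w)))) ⟩
    sum (λ u → sum (λ w → ι (class c u ∧ adj G u w)))
      ≡⟨ ∑-comm (λ u w → ι (class c u ∧ adj G u w)) ⟩
    sum (class-neighbours c) ∎
    where open ≡-Reasoning

  class-degree-sum≤n : ∀ c → ∑∈ (class c) (deg G) ≤ n
  class-degree-sum≤n c = ≤-trans (≤-reflexive (class-degree-sum c)) (∑-≤1 (class-neighbours-≤1 c))

  Lonely : Fin p → Fin n → Set
  Lonely c z = ∀ v → class c v ≡ true → adj G z v ≡ false

  -- A lonely vertex is counted by no class-neighbours term, so the sum drops below n.
  lonely-degree-sum : ∀ {c z} → Lonely c z → ∑∈ (class c) (deg G) < n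
  lonely-degree-sum {c} {z} lonely = ≤-<-trans (≤-reflexive (class-degree-sum c))
    (∑-≤1-gap (class-neighbours-≤1 c) z (count-none {P = λ u → class c u ∧ adj G u z} none))
    where
    none : ∀ u → class c u ∧ adj G u z ≡ false
    none u with class c u in cu
    ... | false = refl
    ... | true  = trans (sym G u z) (lonely u cu)

  -- The colour classes partition the vertices.
  classes-bounded : ∀ {K} → (∀ c → count (class c) ≤ K) → n ≤ p * K
  classes-bounded {K} bounded = begin
    n                              ≡⟨ ≡-sym (count-all n) ⟩
    count {n} (λ _ → true)         ≡⟨ count-fibres (λ _ → true) f ⟩
    sum (λ c → count (class c))    ≤⟨ ∑-mono bounded ⟩
    sum {p} (λ _ → K)              ≡⟨ ∑-const p K ⟩
    p * K                          ∎
    where open ≤-Reasoning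

  large-class : p * 2 < n → ∃ λ c → 3 ≤ count (class c)
  large-class 2p<n with any? (λ c → 3 ≤? count (class c))
  ... | yes found = found
  ... | no  none  =
    contradiction (classes-bounded (λ c → ≤-pred (≰⇒> (λ 3≤ → none (c , 3≤))))) (<⇒≱ 2p<n)

  lonely-or-neighbour : ∀ c w → Lonely c w ⊎ ∃ λ v → class c v ≡ true × adj G w v ≡ true
  lonely-or-neighbour c w with empty-or-witness (λ v → class c v ∧ adj G w v)
  ... | inj₂ (v , h) = inj₂ (v , ∧-true {class c v} h)
  ... | inj₁ none    = inj₁ λ v cv → trans (≡-sym (cong (_∧ adj G w v) cv)) (none v)

  -- If z ~ x inside a three-vertex class, then y has no neighbour in the class:
  -- such a neighbour would be x (common to y and z) or z (common to x and y).
  lonely-after-edge : ∀ {c} (t : Triple (class c)) → adj G (Triple.z t) (Triple.x t) ≡ true →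
                      Σ (Triple (class c)) λ t′ → Lonely c (Triple.z t′)
  lonely-after-edge {c} t zx with lonely-or-neighbour c (Triple.y t)
  ... | inj₁ y-lonely = swap₂₃ t , y-lonely
  ... | inj₂ (v , cv , yv) with Triple.only t v cv
  ...   | inj₁ refl        = contradiction (common-neighbour yv zx (same-class {c} y∈ z∈)) y≢z
    where open Triple t
  ...   | inj₂ (inj₁ refl) = contradiction refl (adj⇒≢ G yv)
  ...   | inj₂ (inj₂ refl) =
    contradiction (common-neighbour (trans (sym G x z) zx) yv (same-class {c} x∈ y∈)) x≢y
    where open Triple t

  -- In a class of exactly three vertices some vertex has no neighbour in the class:
  -- otherwise every vertex would have exactly one, pairing off three vertices.
  lonely-triple : ∀ {c} → Triple (class c) → Σ (Triple (class c)) λ t → Lonely c (Triple.z t)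
  lonely-triple {c} t with lonely-or-neighbour c (Triple.z t)
  ... | inj₁ z-lonely = t , z-lonely
  ... | inj₂ (v , cv , zv) with Triple.only t v cv
  ...   | inj₁ refl        = lonely-after-edge {c} t zv
  ...   | inj₂ (inj₁ refl) = lonely-after-edge {c} (swap₁₂ t) zv
  ...   | inj₂ (inj₂ refl) = contradiction refl (adj⇒≢ G zv)

  module MinDegree (δ : ℕ) (δ≤deg : ∀ v → δ ≤ deg G v) where

    -- Each class c has |c| · δ ≤ (degree sum of c) ≤ n.
    class-size : ∀ K → n < suc K * δ → ∀ c → count (class c) ≤ K
    class-size K n<[1+K]δ c = ≤-pred (*-cancelʳ-< δ (count (class c)) (suc K)
      (≤-<-trans (≤-trans (∑∈-≥ (class c) δ≤deg) (class-degree-sum≤n c)) n<[1+K]δ))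

    colour-bound : ∀ K → n < suc K * δ → n ≤ p * K
    colour-bound K n<[1+K]δ = classes-bounded (class-size K n<[1+K]δ)

    lonely-class-degrees : ∀ {c z} → Lonely c z → ∀ {w} → class c w ≡ true →
                           deg G w + count (class c ─ w) * δ < n
    lonely-class-degrees {c} lonely {w} cw = ≤-<-trans (begin
      deg G w + count (class c ─ w) * δ   ≤⟨ +-monoʳ-≤ (deg G w) (∑∈-≥ (class c ─ w) δ≤deg) ⟩
      deg G w + ∑∈ (class c ─ w) (deg G)  ≡⟨ ≡-sym (∑∈-remove {P = class c} (deg G) cw) ⟩
      ∑∈ (class c) (deg G)                ∎) (lonely-degree-sum {c} lonely)
      where open ≤-Reasoning

    -- If 2p < n < 4δ, some class has three vertices (at least three by counting,
    -- at most three as 4δ > n), one of which is lonely.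
    lonely-class-of-three : p * 2 < n → n < 4 * δ →
      ∃ λ c → count (class c) ≡ 3 × Σ (Triple (class c)) λ t → Lonely c (Triple.z t)
    lonely-class-of-three 2p<n n<4δ with large-class 2p<n
    ... | c , 3≤size = c , size≡3 , lonely-triple {c} (count≡3⇒Triple size≡3)
      where
      size≡3 : count (class c) ≡ 3
      size≡3 = ≤-antisym (class-size 3 n<4δ c) 3≤size

    lonely-three-class : ∀ {c z} → count (class c) ≡ 3 → Lonely c z → 3 * δ < n
    lonely-three-class {c} size≡3 lonely = begin-strict
      3 * δ                 ≡⟨ cong (_* δ) (≡-sym size≡3) ⟩
      count (class c) * δ   ≤⟨ ∑∈-≥ (class c) δ≤deg ⟩
      ∑∈ (class c) (deg G)  <⟨ lonely-degree-sum {c} lonely ⟩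
      n                     ∎
      where open ≤-Reasoning

    -- If n ≤ 3δ then n ≤ 2p, since otherwise a lonely class of three exists.
    three-class-bound : 1 ≤ δ → n ≤ 3 * δ → n ≤ p * 2
    three-class-bound 1≤δ n≤3δ with n ≤? p * 2
    ... | yes n≤2p = n≤2p
    ... | no  n≰2p =
      let n<4δ = ≤-<-trans n≤3δ (m<n+m (3 * δ) 1≤δ)
          (c , size≡3 , _ , lonely) = lonely-class-of-three (≰⇒> n≰2p) n<4δ
      in contradiction n≤3δ (<⇒≱ (lonely-three-class {c} size≡3 lonely))

-- H contains every non-edge of G between distinct vertices (as the complement does).
record Covers {n} (G H : Graph n) : Set where
  field
    cover : ∀ u v → u ≢ v → adj G u v ≡ false → adj H u v ≡ true

module Covering {n} {G H : Graph n} (covers : Covers G H) where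
  open Covers covers

  -- Every vertex other than v is a neighbour of v in G or in H.
  degree-sum : ∀ v → n ≤ suc (deg G v + deg H v)
  degree-sum v = ≤-trans (count-cover (_== v) (λ w → adj G v w ∨ adj H v w) covered)
    (+-mono-≤ (≤-reflexive (count-singleton v)) (count-∨ (adj G v) (adj H v)))
    where
    covered : ∀ w → ((w == v) ∨ (adj G v w ∨ adj H v w)) ≡ true
    covered w with w ≟ v
    ... | yes _ = refl
    ... | no w≢v with adj G v w in Gvw
    ...   | true  = refl
    ...   | false = cover v w (≢-sym w≢v) Gvw

  module _ {q} {g : Fin n → Fin q} (g-inj : IsInjectiveColoring H q g) where
    open InjectiveColouring H g-inj using (deg≤colours)

    -- As deg H v ≤ q, every G-degree is at least n - 1 - q.
    min-degree : ∀ {δ} → δ + suc q ≡ n → ∀ v → δ ≤ deg G v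
    min-degree {δ} δ+1+q≡n v = +-cancelʳ-≤ (suc q) δ (deg G v) (begin
      δ + suc q                ≡⟨ δ+1+q≡n ⟩
      n                        ≤⟨ degree-sum v ⟩
      suc (deg G v + deg H v)  ≡⟨ ≡-sym (+-suc (deg G v) (deg H v)) ⟩
      deg G v + suc (deg H v)  ≤⟨ +-monoʳ-≤ (deg G v) (s≤s (deg≤colours v)) ⟩
      deg G v + suc q          ∎)
      where open ≤-Reasoning

    -- Two distinct vertices of the same H-colour have no common H-neighbour,
    -- so every other vertex is a G-neighbour of one of them.
    twins-cover : ∀ {u z} → u ≢ z → g u ≡ g z → ∀ v → v ≢ u → v ≢ z →
                  adj G u v ≡ true ⊎ adj G z v ≡ true
    twins-cover {u} {z} u≢z gu≡gz v v≢u v≢z with adj G u v in Guv | adj G z v in Gzv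
    ... | true  | _     = inj₁ refl
    ... | false | true  = inj₂ refl
    ... | false | false = contradiction gu≡gz
          (g-inj u z v u≢z (cover u v (≢-sym v≢u) Guv) (cover z v (≢-sym v≢z) Gzv))

    twins-dominate : ∀ {u z} → u ≢ z → g u ≡ g z → n ≤ 2 + (deg G u + deg G z)
    twins-dominate {u} {z} u≢z gu≡gz =
      ≤-trans (count-cover (λ w → (w == u) ∨ (w == z)) (λ w → adj G u w ∨ adj G z w) covered)
              (+-mono-≤ (≤-trans (count-∨ (_== u) (_== z))
                                 (≤-reflexive (cong₂ _+_ (count-singleton u) (count-singleton z))))
                        (count-∨ (adj G u) (adj G z)))
      where
      covered : ∀ w → (((w == u) ∨ (w == z)) ∨ (adj G u w ∨ adj G z w)) ≡ true
      covered w with w ≟ u | w ≟ z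
      ... | yes _   | _       = refl
      ... | no _    | yes _   = refl
      ... | no w≢u  | no w≢z  with twins-cover u≢z gu≡gz w w≢u w≢z
      ...   | inj₁ Guw rewrite Guw = refl
      ...   | inj₂ Gzw rewrite Gzw = ∨-zeroʳ (adj G u w)

-- A class of G of size 3
-- has a lonely vertex z, forcing deg_G z ≤ 2 and so deg_H z ≥ 4; thus z has an
-- H-neighbour u of its own H-colour.  Then u and z dominate G, so deg_G u ≥ 3,
-- and the other two vertices of the class are both G-adjacent to u: a contradiction.
seven-vertices : ∀ {n} {G H : Graph n} → Covers G H →
                 ∀ {f} → IsInjectiveColoring G 3 f → ∀ {g} → IsInjectiveColoring H 4 g → n ≢ 7
seven-vertices {n} {G} {H} covers f-inj {g} g-inj n≡7 =
  refute (lonely-class-of-three (subst (6 <_) (≡-sym n≡7) ≤-refl) (subst (_< 8) (≡-sym n≡7) ≤-refl))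
  where
  open Covering covers
  open InjectiveColouring G f-inj
  open MinDegree 2 (min-degree g-inj (≡-sym n≡7))

  refute : (∃ λ c → count (class c) ≡ 3 × Σ (Triple (class c)) λ t → Lonely c (Triple.z t)) → ⊥
  refute (c , size≡3 , t , lonely) =
    contradiction (common-neighbour (adjacent-to-u x∈ x≢z) (adjacent-to-u y∈ y≢z) (same-class {c} x∈ y∈))
                  x≢y
    where
    open Triple t

    deg≤2 : ∀ {w} → class c w ≡ true → deg G w ≤ 2
    deg≤2 {w} cw = +-cancelʳ-≤ 4 (deg G w) 2
      (≤-pred (subst₂ (λ m k → deg G w + m * 2 < k) others≡2 n≡7 (lonely-class-degrees {c} lonely cw)))
      where
      others≡2 : count (class c ─ w) ≡ 2
      others≡2 = suc-injective (trans (≡-sym (count-remove {P = class c} cw)) size≡3)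

    4≤degH : 4 ≤ deg H z
    4≤degH = +-cancelˡ-≤ 3 4 (deg H z) (begin
      7                        ≡⟨ ≡-sym n≡7 ⟩
      n                        ≤⟨ degree-sum z ⟩
      suc (deg G z + deg H z)  ≤⟨ s≤s (+-monoˡ-≤ (deg H z) (deg≤2 z∈)) ⟩
      3 + deg H z              ∎)
      where open ≤-Reasoning

    twin : ∃ λ u → adj H z u ≡ true × g u ≡ g z
    twin = InjectiveColouring.colour-repeats H g-inj z 4≤degH
    u : Fin n
    u = proj₁ twin
    u≢z : u ≢ z
    u≢z = ≢-sym (adj⇒≢ H (proj₁ (proj₂ twin)))

    3≤deg-u : 3 ≤ deg G u
    3≤deg-u = +-cancelʳ-≤ 2 3 (deg G u) (+-cancelˡ-≤ 2 5 (deg G u + 2) (begin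
      7                        ≡⟨ ≡-sym n≡7 ⟩
      n                        ≤⟨ twins-dominate g-inj u≢z (proj₂ (proj₂ twin)) ⟩
      2 + (deg G u + deg G z)  ≤⟨ +-monoʳ-≤ 2 (+-monoʳ-≤ (deg G u) (deg≤2 z∈)) ⟩
      2 + (deg G u + 2)        ∎))
      where open ≤-Reasoning

    adjacent-to-u : ∀ {w} → class c w ≡ true → w ≢ z → adj G w u ≡ true
    adjacent-to-u {w} cw w≢z with twins-cover g-inj u≢z (proj₂ (proj₂ twin)) w w≢u w≢z
      where
      w≢u : w ≢ u
      w≢u refl = <⇒≱ (s≤s (deg≤2 cw)) 3≤deg-u
    ... | inj₁ Guw = trans (sym G w u) Guw
    ... | inj₂ Gzw = contradiction (trans (≡-sym (lonely w cw)) Gzw) λ ()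

identity-colouring : ∀ {n} (G : Graph n) → InjColorable G n
identity-colouring G = (λ v → v) , λ u v w u≢v _ _ → u≢v

colours-positive : ∀ {n k} → 1 ≤ n → (Fin n → Fin k) → 1 ≤ k
colours-positive {k = zero}  (s≤s _) f = contradiction (f zero) λ ()
colours-positive {k = suc _} _       _ = s≤s z≤n

complement-covers : ∀ {n} (G : Graph n) → Covers G (complement G)
complement-covers G = record { cover = cover }
  where
  cover : ∀ u v → u ≢ v → adj G u v ≡ false → compAdj G u v ≡ true
  cover u v u≢v Guv with u ≟ v
  ... | yes u≡v = contradiction u≡v u≢v
  ... | no  _   rewrite Guv = refl

complement-covered : ∀ {n} (G : Graph n) → Covers (complement G) G
complement-covered G = record { cover = cover }
  where
  cover : ∀ u v → u ≢ v → compAdj G u v ≡ false → adj G u v ≡ true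
  cover u v u≢v Ḡuv with u ≟ v | adj G u v
  ... | yes u≡v | _     = contradiction u≡v u≢v
  ... | no  _   | true  = refl
  ... | no  _   | false = contradiction Ḡuv λ ()

-- For G, H covering each other's non-edges and coloured injectively with p ≥ q
-- colours, p + q < n is impossible once n ≥ 5.  Write q = 1 + r, p = q + d and
-- n = 1 + p + q + k; G has minimum degree n - 1 - q and H has n - 1 - p.
no-small-sum : ∀ {n} {G H : Graph n} → Covers G H → Covers H G →
               ∀ {p f} → IsInjectiveColoring G p f → ∀ {q g} → IsInjectiveColoring H q g →
               5 ≤ n → q ≤ p → p + q < n → ⊥
no-small-sum {G = G} {H} G⊆H H⊆G f-inj {g = g} g-inj 5≤n q≤p p+q<n
  with colours-positive (≤-trans (s≤s z≤n) 5≤n) g | m≤n⇒∃[o]m+o≡n q≤p | m≤n⇒∃[o]m+o≡n p+q<n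
-- d = 0: n ≤ 3 δ_G gives n ≤ 2p = p + q < n.
... | s≤s {n = r} z≤n | 0 , refl | k , refl = <⇒≱ 2p<n (three-class-bound (s≤s z≤n) n≤3δ)
  where
  open InjectiveColouring.MinDegree G f-inj (suc r + k)
       (Covering.min-degree G⊆H g-inj (solve (r ∷ k ∷ [])))
  n≤3δ : suc (suc r + 0 + suc r) + k ≤ 3 * (suc r + k)
  n≤3δ = ≤-by (r + 2 * k) (solve (r ∷ k ∷ []))
  2p<n : (suc r + 0) * 2 < suc (suc r + 0 + suc r) + k
  2p<n = ≤-by k (solve (r ∷ k ∷ []))
-- d = 1 and k = 0: n = 2q + 2 ≤ 3 δ_H = 3q unless q = 1 (n = 4), giving n ≤ 2q < n.
... | s≤s {n = 0} z≤n | 1 , refl | 0 , refl = <⇒≱ (≤-by 0 refl) 5≤n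
... | s≤s {n = suc r} z≤n | 1 , refl | 0 , refl = <⇒≱ 2q<n (three-class-bound (s≤s z≤n) n≤3δ)
  where
  open InjectiveColouring.MinDegree H g-inj (suc (suc r))
       (Covering.min-degree H⊆G f-inj (solve (r ∷ [])))
  n≤3δ : suc (suc (suc r) + 1 + suc (suc r)) + 0 ≤ 3 * suc (suc r)
  n≤3δ = ≤-by r (solve (r ∷ []))
  2q<n : suc (suc r) * 2 < suc (suc (suc r) + 1 + suc (suc r)) + 0
  2q<n = ≤-by 1 (solve (r ∷ []))
-- d + k ≥ 2: n < 2 δ_G, so every class of G is a single vertex and n ≤ p < n.
... | s≤s {n = r} z≤n | 1 , refl | suc k , refl = <⇒≱ p<n (colour-bound 1 n<2δ)
  where
  open InjectiveColouring.MinDegree G f-inj (suc r + 1 + suc k)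
       (Covering.min-degree G⊆H g-inj (solve (r ∷ k ∷ [])))
  n<2δ : suc (suc r + 1 + suc r) + suc k < 2 * (suc r + 1 + suc k)
  n<2δ = ≤-by k (solve (r ∷ k ∷ []))
  p<n : (suc r + 1) * 1 < suc (suc r + 1 + suc r) + suc k
  p<n = ≤-by (2 + r + k) (solve (r ∷ k ∷ []))
... | s≤s {n = r} z≤n | suc (suc e) , refl | k , refl = <⇒≱ p<n (colour-bound 1 n<2δ)
  where
  open InjectiveColouring.MinDegree G f-inj (suc r + suc (suc e) + k)
       (Covering.min-degree G⊆H g-inj (solve (r ∷ e ∷ k ∷ [])))
  n<2δ : suc (suc r + suc (suc e) + suc r) + k < 2 * (suc r + suc (suc e) + k)
  n<2δ = ≤-by (e + k) (solve (r ∷ e ∷ k ∷ []))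
  p<n : (suc r + suc (suc e)) * 1 < suc (suc r + suc (suc e) + suc r) + k
  p<n = ≤-by (suc (r + k)) (solve (r ∷ e ∷ k ∷ []))

-- For G, H as above with p ≥ q colours and n ≥ 7 odd, p + q = n is impossible.
-- Write q = 1 + y and p = q + e, so n = 2q + e and δ_G = y + e, δ_H = y.
no-odd-exact-sum : ∀ {n} {G H : Graph n} → Covers G H → Covers H G →
                   ∀ {p f} → IsInjectiveColoring G p f → ∀ {q g} → IsInjectiveColoring H q g →
                   7 ≤ n → ¬ 2 ∣ n → q ≤ p → p + q ≡ n → ⊥
no-odd-exact-sum {G = G} {H} G⊆H H⊆G f-inj {g = g} g-inj 7≤n odd q≤p p+q≡n
  with colours-positive (≤-trans (s≤s z≤n) 7≤n) g | m≤n⇒∃[o]m+o≡n q≤p | p+q≡n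
-- e = 0 or e = 2: n is even.
... | s≤s {n = y} z≤n | 0 , refl | refl = odd (divides (suc y) (solve (y ∷ [])))
... | s≤s {n = y} z≤n | 2 , refl | refl = odd (divides (suc (suc y)) (solve (y ∷ [])))
-- e ≥ 3: n < 2 δ_G, so n ≤ p < n.
... | s≤s {n = y} z≤n | suc (suc (suc e)) , refl | refl = <⇒≱ p<n (colour-bound 1 n<2δ)
  where
  open InjectiveColouring.MinDegree G f-inj (y + suc (suc (suc e)))
       (Covering.min-degree G⊆H g-inj (solve (y ∷ e ∷ [])))
  n<2δ : suc y + suc (suc (suc e)) + suc y < 2 * (y + suc (suc (suc e)))
  n<2δ = ≤-by e (solve (y ∷ e ∷ []))
  p<n : (suc y + suc (suc (suc e))) * 1 < suc y + suc (suc (suc e)) + suc y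
  p<n = ≤-by y (solve (y ∷ e ∷ []))
-- e = 1, so n = 2y + 3: y ≤ 1 contradicts n ≥ 7, y = 2 is the seven-vertex case,
-- and y ≥ 3 gives n ≤ 3 δ_H, hence n ≤ 2q < n.
... | s≤s {n = 0} z≤n | 1 , refl | refl = <⇒≱ (≤-by 3 refl) 7≤n
... | s≤s {n = 1} z≤n | 1 , refl | refl = <⇒≱ (≤-by 1 refl) 7≤n
... | s≤s {n = 2} z≤n | 1 , refl | refl = seven-vertices H⊆G g-inj f-inj refl
... | s≤s {n = suc (suc (suc y))} z≤n | 1 , refl | refl = <⇒≱ 2q<n (three-class-bound (s≤s z≤n) n≤3δ)
  where
  open InjectiveColouring.MinDegree H g-inj (suc (suc (suc y)))
       (Covering.min-degree H⊆G f-inj (solve (y ∷ [])))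
  n≤3δ : suc (suc (suc (suc y))) + 1 + suc (suc (suc (suc y))) ≤ 3 * suc (suc (suc y))
  n≤3δ = ≤-by y (solve (y ∷ []))
  2q<n : suc (suc (suc (suc y))) * 2 < suc (suc (suc (suc y))) + 1 + suc (suc (suc (suc y)))
  2q<n = ≤-by 0 (solve (y ∷ []))

colour-sum-lower : ∀ {n} {G H : Graph n} → Covers G H → Covers H G →
                   ∀ {p f} → IsInjectiveColoring G p f → ∀ {q g} → IsInjectiveColoring H q g →
                   5 ≤ n → n ≤ p + q
colour-sum-lower {n} G⊆H H⊆G {p} f-inj {q} g-inj 5≤n with n ≤? p + q | ≤-total q p
... | yes n≤p+q | _ = n≤p+q
... | no  n≰p+q | inj₁ q≤p = contradiction (≰⇒> n≰p+q) (no-small-sum G⊆H H⊆G f-inj g-inj 5≤n q≤p)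
... | no  n≰p+q | inj₂ p≤q =
  contradiction (subst (_< n) (+-comm p q) (≰⇒> n≰p+q)) (no-small-sum H⊆G G⊆H g-inj f-inj 5≤n p≤q)

colour-sum-odd : ∀ {n} {G H : Graph n} → Covers G H → Covers H G →
                 ∀ {p f} → IsInjectiveColoring G p f → ∀ {q g} → IsInjectiveColoring H q g →
                 7 ≤ n → ¬ 2 ∣ n → p + q ≢ n
colour-sum-odd G⊆H H⊆G {p} f-inj {q} g-inj 7≤n odd with ≤-total q p
... | inj₁ q≤p = no-odd-exact-sum G⊆H H⊆G f-inj g-inj 7≤n odd q≤p
... | inj₂ p≤q = no-odd-exact-sum H⊆G G⊆H g-inj f-inj 7≤n odd p≤q ∘ trans (+-comm q p)

theorem6 : (n : ℕ) → 5 ≤ n → (G : Graph n) → (a b : ℕ) →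
    IsInjChromaticNumber G a → IsInjChromaticNumber (complement G) b →
    ((n ≡ 5 ⊎ 2 ∣ n) → n ≤ a + b × a + b ≤ 2 * n) ×
    ((7 ≤ n × ¬ (2 ∣ n)) → suc n ≤ a + b × a + b ≤ 2 * n)
theorem6 n 5≤n G a b ((_ , f-inj) , a-minimal) ((_ , g-inj) , b-minimal) =
  (λ _ → lower , upper) ,
  λ { (7≤n , odd) → ≤∧≢⇒< lower (≢-sym (colour-sum-odd G⊆Ḡ Ḡ⊆G f-inj g-inj 7≤n odd)) , upper }
  where
  G⊆Ḡ : Covers G (complement G)
  G⊆Ḡ = complement-covers G
  Ḡ⊆G : Covers (complement G) G
  Ḡ⊆G = complement-covered G
  lower : n ≤ a + b
  lower = colour-sum-lower G⊆Ḡ Ḡ⊆G f-inj g-inj 5≤n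
  upper : a + b ≤ 2 * n
  upper = ≤-trans (+-mono-≤ (a-minimal n (identity-colouring G))
                            (b-minimal n (identity-colouring (complement G))))
                  (≤-reflexive (cong (n +_) (≡-sym (+-identityʳ n))))
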